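{- Let $\lambda/\mu$, $\nu/\rho$ be skew shapes, $D$ the shuffle diagram of shape $(\lambda/\mu)\circledast(\nu/\rho)$, and $T$ a $D$-compatible standard Young tableau. Then $\varphi(T)$ is a Yamanouchi shuffle tableau.
   Context: English convention: $(i,j)$ is row $i$ (top to bottom), column $j$; North = up, East = right. The shuffle diagram $D$ has a square at $(2i-1,2j-1)$ for each square $(i,j)$ of $\lambda/\mu$ and at $(2i,2j)$ for each square $(i,j)$ of $\nu/\rho$. A shuffle tableau is a filling of $D$ by positive integers weakly increasing along rows of $D$ and strictly increasing down columns of $D$. For a shuffle tableau $S$ and $i\ge1$, an $(i,i+1)$-overlap is a pair of squares in the same column, one containing $i$ and the other $i+1$. The $i$-reading word $w_i(S)$ is obtained by taking the squares containing $i$ or $i+1$, deleting all squares in $(i,i+1)$-overlaps, and reading the rest row by row from the bottom row to the top row, each row left to right. Regarding each $i+1$ as "(" and each $i$ as ")" and matching parentheses in the usual way, $E_i$ can be applied to $S$ iff $w_i(S)$ contains an unmatched $i+1$; $S$ is Yamanouchi if no $E_i$ ($i\ge 1$) can be applied. Label the $N$ squares of $D$ by $1,\ldots,N$ row by row from the top row to the bottom row, within each row from right to left. A standard Young tableau $T$ with entries $1,\ldots,N$ is $D$-compatible if: (1) whenever squares $i+1$ and $i$ lie in the same row of $D$, the entry $i+1$ lies in $T$ in a row weakly above and a column strictly to the right of the entry $i$; (2) whenever square $i$ is at $(r,c)$ and square $j$ at $(r+2,c)$ in $D$, the entry $i$ lies in $T$ in a row strictly above and a column weakly to the right of the entry $j$.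 $\varphi(T)$ is the filling of $D$ in which square $i$ receives the index of the row of $T$ containing $i$. -}

module Defs where

open import Data.Nat using (ℕ; zero; suc; _+_; _*_; _≤_; _<_; _≤ᵇ_; _<ᵇ_; _≡ᵇ_; ⌊_/2⌋)
open import Data.Bool using (Bool; true; false; _∧_; _∨_; not; if_then_else_)
open import Data.List using (List; []; _∷_; length; applyUpTo; filterᵇ; reverse; concatMap; map)
open import Data.Nat.ListAction using (sum)
open import Data.Bool.ListAction using (any)
open import Data.Product using (_×_)
open import Relation.Binary.PropositionalEquality using (_≡_)
open import Relation.Nullary using (¬_)

-- Partitions and skew shapes (all indices 1-based, English convention)

-- part κ i = κ_i (1-indexed), 0 for i = 0 or i beyond the list
part : List ℕ → ℕ → ℕ
part []       _             = 0
part (x ∷ xs) zero          = 0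
part (x ∷ xs) (suc zero)    = x
part (x ∷ xs) (suc (suc i)) = part xs (suc i)

IsPartition : List ℕ → Set
IsPartition κ = ∀ i → part κ (suc (suc i)) ≤ part κ (suc i)

IsSkew : List ℕ → List ℕ → Set
IsSkew la mu = IsPartition la × IsPartition mu × (∀ i → part mu i ≤ part la i)

inSkew : List ℕ → List ℕ → ℕ → ℕ → Bool
inSkew la mu i j = (1 ≤ᵇ i) ∧ (part mu i <ᵇ j) ∧ (j ≤ᵇ part la i)

InShape : List ℕ → ℕ → ℕ → Set
InShape κ a b = (1 ≤ a) × (1 ≤ b) × (b ≤ part κ a)

odd : ℕ → Bool
odd zero    = false
odd (suc n) = not (odd n)

-- (r , c) ∈ D  iff  (r,c) = (2i-1,2j-1) with (i,j) ∈ λ/μ,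
--                or (r,c) = (2i,2j)     with (i,j) ∈ ν/ρ
inD : (la mu nu rh : List ℕ) → ℕ → ℕ → Bool
inD la mu nu rh r c =
  if odd r ∧ odd c then inSkew la mu ⌊ suc r /2⌋ ⌊ suc c /2⌋
  else if not (odd r) ∧ not (odd c) then inSkew nu rh ⌊ r /2⌋ ⌊ c /2⌋
  else false

InD : (la mu nu rh : List ℕ) → ℕ → ℕ → Set
InD la mu nu rh r c = inD la mu nu rh r c ≡ true

-- bounds: every square of D lies in rows 1..rowsD and columns 1..colsD
rowsD : (la mu nu rh : List ℕ) → ℕ
rowsD la mu nu rh = 2 * (length la + length nu)

colsD : (la mu nu rh : List ℕ) → ℕ
colsD la mu nu rh = 2 * (part la 1 + part nu 1)

range : ℕ → ℕ → List ℕ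
range a b = filterᵇ (a ≤ᵇ_) (applyUpTo suc b)

countB : List ℕ → (ℕ → Bool) → ℕ
countB xs p = length (filterᵇ p xs)

sizeD : (la mu nu rh : List ℕ) → ℕ
sizeD la mu nu rh =
  sum (map (λ r → countB (range 1 (colsD la mu nu rh)) (inD la mu nu rh r))
           (range 1 (rowsD la mu nu rh)))

-- label of square (r , c): squares numbered row by row from top to bottom,
-- within each row from right to left, starting at 1
label : (la mu nu rh : List ℕ) → ℕ → ℕ → ℕ
label la mu nu rh r c =
  sum (map (λ r' → countB (range 1 (colsD la mu nu rh)) (inD la mu nu rh r'))
           (range 1 (r Data.Nat.∸ 1)))
  + countB (range c (colsD la mu nu rh)) (inD la mu nu rh r)

Filling : Set
Filling = ℕ → ℕ → ℕ

IsShuffleTableau : (la mu nu rh : List ℕ) → Filling → Set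
IsShuffleTableau la mu nu rh S =
    (∀ r c → InD la mu nu rh r c → 1 ≤ S r c)
  × (∀ r c c' → InD la mu nu rh r c → InD la mu nu rh r c' → c < c' → S r c ≤ S r c')
  × (∀ r r' c → InD la mu nu rh r c → InD la mu nu rh r' c → r < r' → S r c < S r' c)

inOverlap : (la mu nu rh : List ℕ) → Filling → ℕ → ℕ → ℕ → Bool
inOverlap la mu nu rh S i r c =
  any (λ r' → inD la mu nu rh r' c ∧
               (((S r c ≡ᵇ i) ∧ (S r' c ≡ᵇ suc i)) ∨ ((S r c ≡ᵇ suc i) ∧ (S r' c ≡ᵇ i))))
      (range 1 (rowsD la mu nu rh))

readingWord : (la mu nu rh : List ℕ) → Filling → ℕ → List ℕ
readingWord la mu nu rh S i =
  concatMap (λ r →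
    concatMap (λ c →
      if inD la mu nu rh r c ∧ ((S r c ≡ᵇ i) ∨ (S r c ≡ᵇ suc i))
           ∧ not (inOverlap la mu nu rh S i r c)
      then S r c ∷ [] else [])
    (range 1 (colsD la mu nu rh)))
  (reverse (range 1 (rowsD la mu nu rh)))

-- number of unmatched "(" (= i+1) when reading left to right with usual
-- parenthesis matching; k = currently open "("s
unmatchedOpen : ℕ → ℕ → List ℕ → ℕ
unmatchedOpen i k [] = k
unmatchedOpen i k (x ∷ w) with x ≡ᵇ suc i | k
... | true  | k'      = unmatchedOpen i (suc k') w
... | false | zero    = unmatchedOpen i zero w
... | false | suc k'  = unmatchedOpen i k' w

EApplicable : (la mu nu rh : List ℕ) → Filling → ℕ → Set
EApplicable la mu nu rh S i = 1 ≤ unmatchedOpen i 0 (readingWord la mu nu rh S i)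

IsYamanouchi : (la mu nu rh : List ℕ) → Filling → Set
IsYamanouchi la mu nu rh S = ∀ i → 1 ≤ i → ¬ EApplicable la mu nu rh S i

IsSYT : List ℕ → ℕ → Filling → Set
IsSYT κ N T =
    IsPartition κ
  × (sum κ ≡ N)
  × (∀ a b → InShape κ a b → (1 ≤ T a b) × (T a b ≤ N))
  × (∀ a b a' b' → InShape κ a b → InShape κ a' b' → T a b ≡ T a' b' → (a ≡ a') × (b ≡ b'))
  × (∀ a b → InShape κ a b → InShape κ a (suc b) → T a b < T a (suc b))
  × (∀ a b → InShape κ a b → InShape κ (suc a) b → T a b < T (suc a) b)

EntryAt : List ℕ → Filling → ℕ → ℕ → ℕ → Set
EntryAt κ T k a b = InShape κ a b × (T a b ≡ k)

IsCompatible : (la mu nu rh : List ℕ) → List ℕ → Filling → Set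
IsCompatible la mu nu rh κ T =
  -- (1) squares i+1 and i in the same row of D
    (∀ r c c' → InD la mu nu rh r c → InD la mu nu rh r c' →
       label la mu nu rh r c' ≡ suc (label la mu nu rh r c) →
       ∀ a b a' b' → EntryAt κ T (label la mu nu rh r c') a b →
                     EntryAt κ T (label la mu nu rh r c) a' b' →
                     (a ≤ a') × (b' < b))
  -- (2) square i at (r,c) and square j at (r+2,c)
  × (∀ r c → InD la mu nu rh r c → InD la mu nu rh (suc (suc r)) c →
       ∀ a b a' b' → EntryAt κ T (label la mu nu rh r c) a b →
                     EntryAt κ T (label la mu nu rh (suc (suc r)) c) a' b' →
                     (a < a') × (b' ≤ b))

IsPhi : (la mu nu rh : List ℕ) → List ℕ → Filling → Filling → Set
IsPhi la mu nu rh κ T S =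
  ∀ r c → InD la mu nu rh r c →
  ∀ a b → EntryAt κ T (label la mu nu rh r c) a b → S r c ≡ a

{-# OPTIONS --safe #-}
module Submission where

-- Write ℓ(x) for the label of a square x of D, so that φ(T)(x) is the row of T containing ℓ(x).
-- Neighbouring squares of a row of D carry consecutive labels, the larger one on the left, and
-- compatibility (1) puts the larger one weakly north in T; down a column, compatibility (2) puts
-- the label of the lower square strictly south. Hence φ(T) is a shuffle tableau.
-- Labels decrease along the reading order, so a suffix of the i-reading word comes from the squares
-- with label at most some n. Every such square carrying i+1, and every overlapped i whose partner
-- i+1 (two rows below) lies outside the suffix, is sent to the entry of T directly above the label
-- of that i+1: it lies in row i and is at most the label of the square, so it labels a square of the
-- suffix carrying i. This injection, together with the pairing of the remaining overlapped i's with
-- overlapped i+1's, shows that every suffix of the i-reading word has at least as many i's as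
-- i+1's, so no i+1 is unmatched.

open import Defs
open import Data.Bool using (Bool; true; false; T?; _∧_; _∨_; not; if_then_else_) renaming (T to True)
open import Data.Bool.Properties using (∧-zeroʳ; ∧-identityʳ; ∨-zeroʳ; ∨-identityʳ; ∧-assoc; T-≡; T-∧; T-∨)
open import Data.Empty using (⊥; ⊥-elim)
open import Data.List
  using (List; []; _∷_; [_]; _++_; length; map; filter; filterᵇ; concatMap; reverse; applyUpTo; cartesianProduct)
open import Data.List.Properties
  using (∷-injectiveʳ; concatMap-++; length-++; length-map; map-++; applyUpTo-∷ʳ; length-applyUpTo;
         reverse-applyUpTo; reverse-map; filter-++; filter-accept; filter-all; filter-none; filter-notAll)
open import Data.List.Membership.Propositional using (_∈_; _∉_; find; lose)
open import Data.List.Membership.Propositional.Properties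
  using (∈-filter⁺; ∈-filter⁻; ∈-map⁺; ∈-map⁻; ∈-applyUpTo⁺; ∈-applyUpTo⁻; ∈-++⁺ʳ; ∈-++⁻;
         ∈-cartesianProduct⁺; ∈-cartesianProduct⁻)
open import Data.List.Relation.Binary.Permutation.Propositional.Properties using (↭-reverse)
import Data.List.Relation.Binary.Sublist.Propositional as Sublist
import Data.List.Relation.Binary.Sublist.Propositional.Properties as Sublist
open import Data.List.Relation.Binary.Subset.Propositional using (_⊆_)
open import Data.List.Relation.Unary.All as All using (All; []; _∷_)
import Data.List.Relation.Unary.All.Properties as All
open import Data.List.Relation.Unary.AllPairs as AllPairs using (AllPairs; []; _∷_)
import Data.List.Relation.Unary.AllPairs.Properties as AllPairs
open import Data.List.Relation.Unary.Any as Any using (Any; here; there; any?)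
import Data.List.Relation.Unary.Any.Properties as Any
open import Data.List.Relation.Unary.Unique.Propositional using (Unique)
import Data.List.Relation.Unary.Unique.Propositional.Properties as Unique
open import Data.Nat
  using (ℕ; zero; suc; _≟_; _+_; _*_; _∸_; _≤_; _≤′_; ≤′-refl; ≤′-step; _<_; _>_; z≤n; s≤s; _≤ᵇ_; _≡ᵇ_; ⌊_/2⌋)
open import Data.Nat.ListAction using (sum)
open import Data.Nat.ListAction.Properties using (sum-++; sum-↭)
open import Data.Nat.Properties
open import Data.Product using (_×_; _,_; proj₁; proj₂; map₁; ∃-syntax)
open import Data.Product.Properties using (≡-dec)
open import Data.Product.Relation.Binary.Lex.Strict using (×-Lex)
open import Data.Sum using (_⊎_; inj₁; inj₂)
open import Function using (id; _∘_; Equivalence)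
open import Relation.Binary.Definitions using (DecidableEquality; Transitive; tri<; tri≈; tri>)
open import Relation.Binary.PropositionalEquality hiding ([_])
open import Relation.Nullary using (¬_; yes; no; does; ¬?; contradiction)

open import Data.List.Membership.DecPropositional _≟_ using () renaming (_∈?_ to _∈ℕ?_)
open import Data.List.Membership.DecPropositional (≡-dec _≟_ _≟_) using () renaming (_∈?_ to _∈ᶜ?_)
open Equivalence using (to; from)

count : {A : Set} → (A → Bool) → List A → ℕ
count p xs = length (filterᵇ p xs)

InjectiveOn : {A B : Set} → (A → B) → List A → Set
InjectiveOn f xs = ∀ {x y} → x ∈ xs → y ∈ xs → f x ≡ f y → x ≡ y

module _ {A : Set} where

  count-++ : (p : A → Bool) (xs ys : List A) → count p (xs ++ ys) ≡ count p xs + count p ys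
  count-++ p xs ys = trans (cong length (filter-++ (T? ∘ p) xs ys)) (length-++ (filterᵇ p xs))

  count-split : (p q : A → Bool) (xs : List A) →
    count p xs ≡ count (λ x → p x ∧ q x) xs + count (λ x → p x ∧ not (q x)) xs
  count-split p q [] = refl
  count-split p q (x ∷ xs) with p x | q x
  ... | true  | true  = cong suc (count-split p q xs)
  ... | true  | false = trans (cong suc (count-split p q xs)) (sym (+-suc _ _))
  ... | false | _     = count-split p q xs

  count-∨ : (p q : A → Bool) (xs : List A) → (∀ x → True (p x) → True (q x) → ⊥) →
    count (λ x → p x ∨ q x) xs ≡ count p xs + count q xs
  count-∨ p q [] _ = refl
  count-∨ p q (x ∷ xs) disjoint with p x in px | q x in qx
  ... | true  | true  = ⊥-elim (disjoint x (subst True (sym px) _) (subst True (sym qx) _))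
  ... | true  | false = cong suc (count-∨ p q xs disjoint)
  ... | false | true  = trans (cong suc (count-∨ p q xs disjoint)) (sym (+-suc _ _))
  ... | false | false = count-∨ p q xs disjoint

  count-cong : (p q : A → Bool) (xs : List A) → (∀ x → p x ≡ q x) → count p xs ≡ count q xs
  count-cong p q [] _ = refl
  count-cong p q (x ∷ xs) p≗q with p x | q x | p≗q x
  ... | true  | .true  | refl = cong suc (count-cong p q xs p≗q)
  ... | false | .false | refl = count-cong p q xs p≗q

  count-map : {C : Set} (p : C → Bool) (f : A → C) (xs : List A) → count p (map f xs) ≡ count (p ∘ f) xs
  count-map p f [] = refl
  count-map p f (x ∷ xs) with p (f x)
  ... | true  = cong suc (count-map p f xs)
  ... | false = count-map p f xs

  unique-map : {B : Set} {f : A → B} {xs : List A} → Unique xs → InjectiveOn f xs → Unique (map f xs)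
  unique-map [] _ = []
  unique-map (x∉xs ∷ u) inj =
    All.map⁺ (All.tabulate (λ y∈ fx≡fy → All.lookup x∉xs y∈ (inj (here refl) (there y∈) fx≡fy)))
    ∷ unique-map u (λ x∈ y∈ → inj (there x∈) (there y∈))

∈-interval : ∀ {ℓ n} → 1 ≤ ℓ → ℓ ≤ n → ℓ ∈ applyUpTo suc n
∈-interval {suc k} _ k<n = ∈-applyUpTo⁺ suc k<n

module _ {A : Set} (_≟_ : DecidableEquality A) where

  unique-⊆⇒length-≤ : {xs ys : List A} → Unique xs → xs ⊆ ys → length xs ≤ length ys
  unique-⊆⇒length-≤ [] _ = z≤n
  unique-⊆⇒length-≤ {x ∷ xs} {ys} (x∉xs ∷ u) x∷xs⊆ys = begin-strict
    length xs                                ≤⟨ unique-⊆⇒length-≤ u xs⊆ys-x ⟩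
    length (filter (λ y → ¬? (x ≟ y)) ys)    <⟨ filter-notAll (λ y → ¬? (x ≟ y)) ys x∈ys ⟩
    length ys                                ∎
    where
    open ≤-Reasoning
    xs⊆ys-x : xs ⊆ filter (λ y → ¬? (x ≟ y)) ys
    xs⊆ys-x y∈xs = ∈-filter⁺ (λ y → ¬? (x ≟ y)) (x∷xs⊆ys (there y∈xs)) (All.lookup x∉xs y∈xs)
    x∈ys : Any (λ y → ¬ x ≢ y) ys
    x∈ys = Any.map (λ x≡y x≢y → x≢y x≡y) (x∷xs⊆ys (here refl))

length-≤-of-injection : {A B : Set} → DecidableEquality B → (f : A → B) {xs : List A} {ys : List B} →
  Unique xs → InjectiveOn f xs → (∀ {x} → x ∈ xs → f x ∈ ys) → length xs ≤ length ys
length-≤-of-injection _≟_ f {xs} {ys} u inj lands = subst (_≤ _) (length-map f xs)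
  (unique-⊆⇒length-≤ _≟_ (unique-map u inj) image⊆ys)
  where
  image⊆ys : map f xs ⊆ ys
  image⊆ys fx∈ with ∈-map⁻ f fx∈
  ... | x , x∈ , refl = lands x∈

injective-into-interval⇒onto : {A : Set} (f : A → ℕ) (xs : List A) → Unique xs → InjectiveOn f xs →
  (∀ {x} → x ∈ xs → 1 ≤ f x × f x ≤ length xs) →
  ∀ {ℓ} → 1 ≤ ℓ → ℓ ≤ length xs → ∃[ x ] x ∈ xs × f x ≡ ℓ
injective-into-interval⇒onto f xs u inj bounds {ℓ} 1≤ℓ ℓ≤n with ℓ ∈ℕ? map f xs
... | yes ℓ∈ = let (x , x∈ , ℓ≡fx) = ∈-map⁻ f ℓ∈ in x , x∈ , sym ℓ≡fx
... | no ℓ∉ = contradiction too-long (<-irrefl refl)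
  where
  n = length xs
  ℓ∷image⊆interval : ℓ ∷ map f xs ⊆ applyUpTo suc n
  ℓ∷image⊆interval (here refl) = ∈-interval 1≤ℓ ℓ≤n
  ℓ∷image⊆interval (there m) with ∈-map⁻ f m
  ... | x , x∈ , refl = let (1≤fx , fx≤n) = bounds x∈ in ∈-interval 1≤fx fx≤n
  too-long : suc n ≤ n
  too-long = subst₂ _≤_ (cong suc (length-map f xs)) (length-applyUpTo suc n)
    (unique-⊆⇒length-≤ _≟_
      (All.tabulate (λ m ℓ≡y → ℓ∉ (subst (_∈ map f xs) (sym ℓ≡y) m)) ∷ unique-map u inj)
      ℓ∷image⊆interval)

module _ {A B : Set} where

  concatMap-cartesianProduct : {C : Set} (g : A → B → List C) (xs : List A) (ys : List B) →
    concatMap (λ x → concatMap (g x) ys) xs ≡ concatMap (λ z → g (proj₁ z) (proj₂ z)) (cartesianProduct xs ys)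
  concatMap-cartesianProduct g [] ys = refl
  concatMap-cartesianProduct g (x ∷ xs) ys =
    trans (cong₂ _++_ (row ys) (concatMap-cartesianProduct g xs ys))
          (sym (concatMap-++ (λ z → g (proj₁ z) (proj₂ z)) (map (x ,_) ys) (cartesianProduct xs ys)))
    where
    row : ∀ ys → concatMap (g x) ys ≡ concatMap (λ z → g (proj₁ z) (proj₂ z)) (map (x ,_) ys)
    row [] = refl
    row (y ∷ ys) = cong (g x y ++_) (row ys)

  count-cartesianProduct : (p : A × B → Bool) (xs : List A) (ys : List B) →
    count p (cartesianProduct xs ys) ≡ sum (map (λ x → count (λ y → p (x , y)) ys) xs)
  count-cartesianProduct p [] ys = refl
  count-cartesianProduct p (x ∷ xs) ys =
    trans (count-++ p (map (x ,_) ys) (cartesianProduct xs ys))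
          (cong₂ _+_ (count-map p (x ,_) ys) (count-cartesianProduct p xs ys))

  cartesianProduct-lex : {R : A → A → Set} {S : B → B → Set} {xs : List A} {ys : List B} →
    AllPairs R xs → AllPairs S ys → AllPairs (×-Lex _≡_ R S) (cartesianProduct xs ys)
  cartesianProduct-lex [] _ = []
  cartesianProduct-lex {xs = x ∷ xs} {ys} (x<xs ∷ sorted-xs) sorted-ys =
    AllPairs.++⁺ (AllPairs.map⁺ (AllPairs.map (λ s → inj₂ (refl , s)) sorted-ys))
                 (cartesianProduct-lex sorted-xs sorted-ys)
                 (All.map⁺ (All.tabulate (λ _ → All.tabulate (λ {z} z∈ →
                   inj₁ (All.lookup x<xs (proj₁ (∈-cartesianProduct⁻ xs ys z∈)))))))

allPairs-++⁻ : {A : Set} {R : A → A → Set} (xs : List A) {ys : List A} → AllPairs R (xs ++ ys) →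
  AllPairs R ys × (∀ {x y} → x ∈ xs → y ∈ ys → R x y)
allPairs-++⁻ []       sorted = sorted , λ ()
allPairs-++⁻ (x ∷ xs) (x<rest ∷ sorted) =
  let (sorted-ys , cross) = allPairs-++⁻ xs sorted
  in sorted-ys , λ { (here refl) y∈ → All.lookup x<rest (∈-++⁺ʳ xs y∈)
                   ; (there x∈) y∈ → cross x∈ y∈ }

select : {A B : Set} → (A → Bool) → (A → B) → A → List B
select p f x = if p x then f x ∷ [] else []

module _ {A B : Set} (p : A → Bool) (f : A → B) where

  count-concatMap-select : (q : B → Bool) (xs : List A) →
    count q (concatMap (select p f) xs) ≡ count (λ x → p x ∧ q (f x)) xs
  count-concatMap-select q [] = refl
  count-concatMap-select q (x ∷ xs) with p x
  ... | false = count-concatMap-select q xs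
  ... | true with q (f x)
  ...   | true  = cong suc (count-concatMap-select q xs)
  ...   | false = count-concatMap-select q xs

  suffix-concatMap-select : (xs : List A) {us v : List B} → us ++ v ≡ concatMap (select p f) xs →
    ∃[ ys ] ∃[ zs ] ys ++ zs ≡ xs × v ≡ concatMap (select p f) zs
  suffix-concatMap-select [] {[]} v≡[] = [] , [] , refl , v≡[]
  suffix-concatMap-select (x ∷ xs) {[]} v≡ = [] , x ∷ xs , refl , v≡
  suffix-concatMap-select (x ∷ xs) {u ∷ us} eq with p x
  ... | true  = let (ys , zs , ys++zs≡xs , v≡) = suffix-concatMap-select xs (∷-injectiveʳ eq)
                in x ∷ ys , zs , cong (x ∷_) ys++zs≡xs , v≡
  ... | false = let (ys , zs , ys++zs≡xs , v≡) = suffix-concatMap-select xs {u ∷ us} eq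
                in x ∷ ys , zs , cong (x ∷_) ys++zs≡xs , v≡

EverySuffix : {A : Set} → (List A → Set) → List A → Set
EverySuffix P w = ∀ us v → us ++ v ≡ w → P v

everySuffix-tail : {A : Set} (P : List A → Set) {x : A} {w : List A} → EverySuffix P (x ∷ w) → EverySuffix P w
everySuffix-tail P {x} h us v eq = h (x ∷ us) v (cong (x ∷_) eq)

-- As in unmatchedOpen, every letter other than i+1 counts as a closing bracket.
opens closes : ℕ → List ℕ → ℕ
opens i w = count (_≡ᵇ suc i) w
closes i w = count (λ x → not (x ≡ᵇ suc i)) w

Balanced : ℕ → List ℕ → Set
Balanced i w = opens i w ≤ closes i w

unmatchedOpen-≡0 : ∀ i k w → EverySuffix (Balanced i) w →
  k + opens i w ≤ closes i w → unmatchedOpen i k w ≡ 0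
unmatchedOpen-≡0 i k [] _ k≤0 = n≤0⇒n≡0 (subst (_≤ 0) (+-identityʳ k) k≤0)
unmatchedOpen-≡0 i k (x ∷ w) balanced k+o≤c with x ≡ᵇ suc i | k
... | true  | k′     = unmatchedOpen-≡0 i (suc k′) w (everySuffix-tail (Balanced i) balanced)
                        (subst (_≤ closes i w) (+-suc k′ (opens i w)) k+o≤c)
... | false | zero   = unmatchedOpen-≡0 i 0 w (everySuffix-tail (Balanced i) balanced) (balanced [ x ] w refl)
... | false | suc k′ = unmatchedOpen-≡0 i k′ w (everySuffix-tail (Balanced i) balanced) (≤-pred k+o≤c)

≡true⇒True : ∀ {b} → b ≡ true → True b
≡true⇒True = from T-≡

True⇒≡true : ∀ {b} → True b → b ≡ true
True⇒≡true = to T-≡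

∧-∨-restrictʳ : ∀ d a b o → (d ∧ (a ∨ b) ∧ not o) ∧ b ≡ (d ∧ b) ∧ not o
∧-∨-restrictʳ d a true  o
  rewrite ∧-identityʳ (d ∧ (a ∨ true) ∧ not o) | ∨-zeroʳ a | ∧-identityʳ d = refl
∧-∨-restrictʳ d a false o
  rewrite ∧-zeroʳ (d ∧ (a ∨ false) ∧ not o) | ∧-zeroʳ d = refl

∧-∨-restrictˡ : ∀ d a b o → (True a → True b → ⊥) →
  (d ∧ (a ∨ b) ∧ not o) ∧ not b ≡ (d ∧ a) ∧ not o
∧-∨-restrictˡ d a     false o _
  rewrite ∧-identityʳ (d ∧ (a ∨ false) ∧ not o) | ∨-identityʳ a = sym (∧-assoc d a (not o))
∧-∨-restrictˡ d false true  o _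
  rewrite ∧-zeroʳ (d ∧ true ∧ not o) | ∧-zeroʳ d = refl
∧-∨-restrictˡ d true  true  o disjoint = ⊥-elim (disjoint _ _)

exchange-cancel : ∀ {a b l p m} → (a + b) + l ≤ (p + l) + m → p ≤ a → b ≤ m
exchange-cancel {a} {b} {l} {p} {m} a+b+l≤p+l+m p≤a =
  +-cancelˡ-≤ a b m (≤-trans (+-cancelʳ-≤ l (a + b) (p + m) (subst ((a + b) + l ≤_) exchange a+b+l≤p+l+m))
                             (+-monoˡ-≤ m p≤a))
  where
  exchange : (p + l) + m ≡ (p + m) + l
  exchange = trans (+-assoc p l m) (trans (cong (p +_) (+-comm l m)) (sym (+-assoc p m l)))

pairwise-from-adjacent : {P : ℕ → Set} (_∼_ : ℕ → ℕ → Set) → Transitive _∼_ →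
  (∀ {c c′} → P c → P c′ → c < c′ → P (2 + c) × 2 + c ≤ c′) →
  (∀ {c} → P c → P (2 + c) → c ∼ (2 + c)) →
  ∀ {c c′} → P c → P c′ → c < c′ → c ∼ c′
pairwise-from-adjacent {P} _∼_ ∼-trans step adjacent {c} {c′} p p′ = go c′ (m≤m+n c′ c) p
  where
  fuel-step : ∀ n c → c′ ≤ suc n + c → c′ ≤ n + (2 + c)
  fuel-step n c c′≤ = ≤-trans c′≤ (≤-trans (n≤1+n _)
    (≤-reflexive (sym (trans (+-suc n (suc c)) (cong suc (+-suc n c))))))
  go : ∀ n {c} → c′ ≤ n + c → P c → c < c′ → c ∼ c′
  go zero    c′≤c _ c<c′ = contradiction c′≤c (<⇒≱ c<c′)
  go (suc n) {c} c′≤ p c<c′ with step p p′ c<c′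
  ... | p₂ , 2+c≤c′ with m≤n⇒m<n∨m≡n 2+c≤c′
  ...   | inj₂ refl   = adjacent p p₂
  ...   | inj₁ 2+c<c′ = ∼-trans (adjacent p p₂) (go n (fuel-step n c c′≤) p₂ 2+c<c′)

range-1 : ∀ n → range 1 n ≡ applyUpTo suc n
range-1 n = filter-all (T? ∘ (1 ≤ᵇ_)) (All.applyUpTo⁺₁ suc n (λ _ → _))

∈-range-1 : ∀ {ℓ n} → 1 ≤ ℓ → ℓ ≤ n → ℓ ∈ range 1 n
∈-range-1 {n = n} 1≤ℓ ℓ≤n = subst (_ ∈_) (sym (range-1 n)) (∈-interval 1≤ℓ ℓ≤n)

range-suc : ∀ c n → range c (suc n) ≡ range c n ++ filterᵇ (c ≤ᵇ_) [ suc n ]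
range-suc c n = trans (cong (filterᵇ (c ≤ᵇ_)) (sym (applyUpTo-∷ʳ suc n)))
                      (filter-++ (T? ∘ (c ≤ᵇ_)) (applyUpTo suc n) [ suc n ])

range-empty : ∀ {c n} → n < c → range c n ≡ []
range-empty {c} {n} n<c = filter-none (T? ∘ (c ≤ᵇ_))
  (All.applyUpTo⁺₁ suc n (λ {i} i<n c≤1+i → <⇒≱ (≤-<-trans i<n n<c) (≤ᵇ⇒≤ c (suc i) c≤1+i)))

filter-≤ᵇ-singleton : ∀ {c k} → c ≤ k → filterᵇ (c ≤ᵇ_) [ k ] ≡ [ k ]
filter-≤ᵇ-singleton {c} {k} c≤k = filter-accept (T? ∘ (c ≤ᵇ_)) {k} {[]} (≤⇒≤ᵇ c≤k)

range-cons : ∀ {c n} → 1 ≤ c → c ≤ n → range c n ≡ c ∷ range (suc c) n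
range-cons {n = zero} 1≤c z≤n = contradiction 1≤c λ ()
range-cons {c} {suc n} 1≤c c≤1+n with m≤n⇒m<n∨m≡n c≤1+n
... | inj₁ (s≤s c≤n) = begin
  range c (suc n)                                        ≡⟨ range-suc c n ⟩
  range c n ++ filterᵇ (c ≤ᵇ_) [ suc n ]
    ≡⟨ cong₂ _++_ (range-cons 1≤c c≤n) (filter-≤ᵇ-singleton c≤1+n) ⟩
  c ∷ range (suc c) n ++ [ suc n ]
    ≡⟨ cong (λ l → c ∷ range (suc c) n ++ l) (sym (filter-≤ᵇ-singleton (s≤s c≤n))) ⟩
  c ∷ range (suc c) n ++ filterᵇ (suc c ≤ᵇ_) [ suc n ]   ≡⟨ cong (c ∷_) (sym (range-suc (suc c) n)) ⟩
  c ∷ range (suc c) (suc n)                              ∎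
  where open ≡-Reasoning
... | inj₂ refl = begin
  range (suc n) (suc n)                                  ≡⟨ range-suc (suc n) n ⟩
  range (suc n) n ++ filterᵇ (suc n ≤ᵇ_) [ suc n ]
    ≡⟨ cong₂ _++_ (range-empty {suc n} {n} ≤-refl) (filter-≤ᵇ-singleton {suc n} ≤-refl) ⟩
  [ suc n ]
    ≡⟨ cong (suc n ∷_) (sym (range-empty {suc (suc n)} {suc n} ≤-refl)) ⟩
  suc n ∷ range (suc (suc n)) (suc n)                    ∎
  where open ≡-Reasoning

module _ (p : ℕ → Bool) {c n : ℕ} (1≤c : 1 ≤ c) (c≤n : c ≤ n) where

  countB-range-accept : p c ≡ true → countB (range c n) p ≡ suc (countB (range (suc c) n) p)
  countB-range-accept pc rewrite range-cons 1≤c c≤n | pc = refl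

  countB-range-reject : p c ≡ false → countB (range c n) p ≡ countB (range (suc c) n) p
  countB-range-reject pc rewrite range-cons 1≤c c≤n | pc = refl

countB-range-antitone : ∀ (p : ℕ → Bool) {c c′} n → c ≤ c′ →
  countB (range c′ n) p ≤ countB (range c n) p
countB-range-antitone p {c} {c′} n c≤c′ =
  Sublist.length-mono-≤ (Sublist.filter⁺ (T? ∘ p) (T? ∘ p) (λ { refl → id })
    (Sublist.filter⁺ (T? ∘ (c′ ≤ᵇ_)) (T? ∘ (c ≤ᵇ_)) {applyUpTo suc n}
      (λ { {x} refl c′≤x → ≤⇒≤ᵇ (≤-trans c≤c′ (≤ᵇ⇒≤ c′ x c′≤x)) }) Sublist.⊆-refl))

module _ (W : ℕ → ℕ) where

  sum-range-suc : ∀ n → sum (map W (range 1 (suc n))) ≡ sum (map W (range 1 n)) + W (suc n)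
  sum-range-suc n = begin
    sum (map W (range 1 (suc n)))                 ≡⟨ cong (sum ∘ map W) (range-suc 1 n) ⟩
    sum (map W (range 1 n ++ [ suc n ]))          ≡⟨ cong sum (map-++ W (range 1 n) [ suc n ]) ⟩
    sum (map W (range 1 n) ++ [ W (suc n) ])      ≡⟨ sum-++ (map W (range 1 n)) [ W (suc n) ] ⟩
    sum (map W (range 1 n)) + (W (suc n) + 0)     ≡⟨ cong (sum (map W (range 1 n)) +_) (+-identityʳ _) ⟩
    sum (map W (range 1 n)) + W (suc n)           ∎
    where open ≡-Reasoning

  sum-range-mono : ∀ {m n} → m ≤ n → sum (map W (range 1 m)) ≤ sum (map W (range 1 n))
  sum-range-mono {m} {zero} z≤n = ≤-refl
  sum-range-mono {m} {suc n} m≤1+n with m≤n⇒m<n∨m≡n m≤1+n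
  ... | inj₁ (s≤s m≤n) = ≤-trans (sum-range-mono m≤n)
                           (subst (sum (map W (range 1 n)) ≤_) (sym (sum-range-suc n)) (m≤m+n _ (W (suc n))))
  ... | inj₂ refl = ≤-refl

-- Skew shapes and the shuffle diagram

Cell : Set
Cell = ℕ × ℕ

part-antitone : ∀ κ → IsPartition κ → ∀ {i i′} → 1 ≤ i → i ≤ i′ → part κ i′ ≤ part κ i
part-antitone κ P 1≤i i≤i′ = go 1≤i (≤⇒≤′ i≤i′)
  where
  go : ∀ {i i′} → 1 ≤ i → i ≤′ i′ → part κ i′ ≤ part κ i
  go _ ≤′-refl = ≤-refl
  go {i′ = suc (suc k)} 1≤i (≤′-step i≤′1+k) = ≤-trans (P k) (go 1≤i i≤′1+k)
  go {i′ = suc zero} 1≤i (≤′-step i≤′0) = contradiction (≤-trans 1≤i (≤′⇒≤ i≤′0)) λ ()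

part-pos⇒≤length : ∀ κ i → 1 ≤ part κ i → i ≤ length κ
part-pos⇒≤length (x ∷ κ) zero          _ = z≤n
part-pos⇒≤length (x ∷ κ) (suc zero)    _ = s≤s z≤n
part-pos⇒≤length (x ∷ κ) (suc (suc i)) p = s≤s (part-pos⇒≤length κ (suc i) p)

InSkew : List ℕ → List ℕ → ℕ → ℕ → Set
InSkew la mu i j = (1 ≤ i) × (part mu i < j) × (j ≤ part la i)

module _ (la mu : List ℕ) {i j : ℕ} where

  inSkew⁻ : inSkew la mu i j ≡ true → InSkew la mu i j
  inSkew⁻ e =
    let (t₁ , t₂₃) = to T-∧ (≡true⇒True e)
        (t₂ , t₃)  = to T-∧ t₂₃
    in ≤ᵇ⇒≤ 1 i t₁ , <ᵇ⇒< (part mu i) j t₂ , ≤ᵇ⇒≤ j (part la i) t₃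

  inSkew⁺ : InSkew la mu i j → inSkew la mu i j ≡ true
  inSkew⁺ (1≤i , μ<j , j≤λ) =
    True⇒≡true (from T-∧ (≤⇒≤ᵇ 1≤i , from T-∧ (<⇒<ᵇ μ<j , ≤⇒≤ᵇ j≤λ)))

module _ (la mu : List ℕ) where

  inSkew-right : ∀ {i j j′} → InSkew la mu i j → InSkew la mu i j′ → j < j′ → InSkew la mu i (suc j)
  inSkew-right (1≤i , μ<j , _) (_ , _ , j′≤λ) j<j′ = 1≤i , m≤n⇒m≤1+n μ<j , ≤-trans j<j′ j′≤λ

  inSkew-down : IsPartition la → IsPartition mu → ∀ {i i′ j} →
    InSkew la mu i j → InSkew la mu i′ j → i < i′ → InSkew la mu (suc i) j
  inSkew-down Pλ Pμ {i} (1≤i , μ<j , _) (_ , _ , j≤λ′) i<i′ =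
    s≤s z≤n ,
    ≤-<-trans (part-antitone mu Pμ 1≤i (n≤1+n i)) μ<j ,
    ≤-trans j≤λ′ (part-antitone la Pλ (s≤s z≤n) i<i′)

  inSkew-bounds : IsPartition la → ∀ {i j} → InSkew la mu i j →
    (i ≤ length la) × (1 ≤ j) × (j ≤ part la 1)
  inSkew-bounds Pλ {i} (1≤i , μ<j , j≤λ) =
    let 1≤j = ≤-trans (s≤s z≤n) μ<j
    in part-pos⇒≤length la i (≤-trans 1≤j j≤λ) , 1≤j , ≤-trans j≤λ (part-antitone la Pλ ≤-refl 1≤i)

double : ℕ → ℕ
double zero    = zero
double (suc n) = suc (suc (double n))

odd-double : ∀ n → odd (double n) ≡ false
odd-double zero    = refl
odd-double (suc n) = cong (not ∘ not) (odd-double n)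

half-double : ∀ n → ⌊ double n /2⌋ ≡ n
half-double zero    = refl
half-double (suc n) = cong suc (half-double n)

double-injective : ∀ {m n} → double m ≡ double n → m ≡ n
double-injective {m} {n} e = trans (sym (half-double m)) (trans (cong ⌊_/2⌋ e) (half-double n))

double-mono : ∀ {m n} → m ≤ n → double m ≤ double n
double-mono z≤n       = z≤n
double-mono (s≤s m≤n) = s≤s (s≤s (double-mono m≤n))

double-cancel-< : ∀ {m n} → double m < double n → m < n
double-cancel-< {m} {n} dm<dn = ≰⇒> (λ n≤m → <⇒≱ dm<dn (double-mono n≤m))

odd≢double : ∀ {m n} → suc (double m) ≢ double n
odd≢double {m} {n} e =
  contradiction (trans (sym (cong not (odd-double m))) (trans (cong odd e) (odd-double n))) λ ()

parity : ∀ n → ∃[ k ] (n ≡ double k ⊎ n ≡ suc (double k))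
parity zero = 0 , inj₁ refl
parity (suc n) with parity n
... | k , inj₁ refl = k , inj₂ refl
... | k , inj₂ refl = suc k , inj₁ refl

≤double : ∀ {k n} → k ≤ n → double k ≤ 2 * n
≤double {k} {n} k≤n = subst (double k ≤_) (double≡2* n) (double-mono k≤n)
  where
  double≡2* : ∀ n → double n ≡ 2 * n
  double≡2* zero    = refl
  double≡2* (suc n) = cong suc (trans (cong suc (double≡2* n)) (sym (+-suc n (n + 0))))

module Diagram (la mu nu rh : List ℕ) (skew-λμ : IsSkew la mu) (skew-νρ : IsSkew nu rh) where

  data Square (r c : ℕ) : Set where
    λμ-square : ∀ k l → r ≡ suc (double k) → c ≡ suc (double l) → InSkew la mu (suc k) (suc l) →
                Square r c
    νρ-square : ∀ k l → r ≡ double k → c ≡ double l → InSkew nu rh k l → Square r c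

  private
    inD-odd : ∀ k l → inD la mu nu rh (suc (double k)) (suc (double l)) ≡ inSkew la mu (suc k) (suc l)
    inD-odd k l rewrite odd-double k | odd-double l | half-double k | half-double l = refl

    inD-even : ∀ k l → inD la mu nu rh (double k) (double l) ≡ inSkew nu rh k l
    inD-even k l rewrite odd-double k | odd-double l | half-double k | half-double l = refl

    inD-odd-even : ∀ k l → inD la mu nu rh (suc (double k)) (double l) ≡ false
    inD-odd-even k l rewrite odd-double k | odd-double l = refl

    inD-even-odd : ∀ k l → inD la mu nu rh (double k) (suc (double l)) ≡ false
    inD-even-odd k l rewrite odd-double k | odd-double l = refl

  square : ∀ {r c} → InD la mu nu rh r c → Square r c
  square {r} {c} e with parity r | parity c
  ... | k , inj₁ refl | l , inj₁ refl = νρ-square k l refl refl (inSkew⁻ nu rh (trans (sym (inD-even k l)) e))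
  ... | k , inj₁ refl | l , inj₂ refl = contradiction (trans (sym e) (inD-even-odd k l)) λ ()
  ... | k , inj₂ refl | l , inj₁ refl = contradiction (trans (sym e) (inD-odd-even k l)) λ ()
  ... | k , inj₂ refl | l , inj₂ refl = λμ-square k l refl refl (inSkew⁻ la mu (trans (sym (inD-odd k l)) e))

  square⁻¹ : ∀ {r c} → Square r c → InD la mu nu rh r c
  square⁻¹ (λμ-square k l refl refl s) = trans (inD-odd k l) (inSkew⁺ la mu s)
  square⁻¹ (νρ-square k l refl refl s) = trans (inD-even k l) (inSkew⁺ nu rh s)

  no-square-right : ∀ {r c} → Square r c → inD la mu nu rh r (suc c) ≡ false
  no-square-right (λμ-square k l refl refl _) = inD-odd-even k (suc l)
  no-square-right (νρ-square k l refl refl _) = inD-even-odd k l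

  square-row-step : ∀ {r c c′} → Square r c → Square r c′ → c < c′ → Square r (2 + c) × 2 + c ≤ c′
  square-row-step (λμ-square k l refl refl s) (λμ-square k′ l′ r≡ refl s′) c<c′
    with refl ← double-injective (suc-injective r≡) =
    let l<l′ = double-cancel-< (≤-pred c<c′) in
    λμ-square k (suc l) refl refl (inSkew-right la mu s s′ (s≤s l<l′)) , s≤s (double-mono l<l′)
  square-row-step (λμ-square _ _ refl _ _) (νρ-square _ _ r≡ _ _) _ = contradiction r≡ odd≢double
  square-row-step (νρ-square _ _ refl _ _) (λμ-square _ _ r≡ _ _) _ = contradiction (sym r≡) odd≢double
  square-row-step (νρ-square k l refl refl s) (νρ-square k′ l′ r≡ refl s′) c<c′
    with refl ← double-injective r≡ =
    let l<l′ = double-cancel-< c<c′ in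
    νρ-square k (suc l) refl refl (inSkew-right nu rh s s′ l<l′) , double-mono l<l′

  square-column-step : ∀ {r r′ c} → Square r c → Square r′ c → r < r′ → Square (2 + r) c × 2 + r ≤ r′
  square-column-step (λμ-square k l refl refl s) (λμ-square k′ l′ refl c≡ s′) r<r′
    with refl ← double-injective (suc-injective c≡) =
    let k<k′ = double-cancel-< (≤-pred r<r′) in
    λμ-square (suc k) l refl refl (inSkew-down la mu (proj₁ skew-λμ) (proj₁ (proj₂ skew-λμ)) s s′ (s≤s k<k′))
    , s≤s (double-mono k<k′)
  square-column-step (λμ-square _ _ _ refl _) (νρ-square _ _ _ c≡ _) _ = contradiction c≡ odd≢double
  square-column-step (νρ-square _ _ _ refl _) (λμ-square _ _ _ c≡ _) _ = contradiction (sym c≡) odd≢double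
  square-column-step (νρ-square k l refl refl s) (νρ-square k′ l′ refl c≡ s′) r<r′
    with refl ← double-injective c≡ =
    let k<k′ = double-cancel-< r<r′ in
    νρ-square (suc k) l refl refl (inSkew-down nu rh (proj₁ skew-νρ) (proj₁ (proj₂ skew-νρ)) s s′ k<k′)
    , double-mono k<k′

  R C : ℕ
  R = rowsD la mu nu rh
  C = colsD la mu nu rh

  square-bounds : ∀ {r c} → Square r c → (1 ≤ r) × (r ≤ R) × (1 ≤ c) × (c ≤ C)
  square-bounds (λμ-square k l refl refl s) =
    let (k<λ , _ , l<λ₁) = inSkew-bounds la mu (proj₁ skew-λμ) s
    in s≤s z≤n , ≤-trans (n≤1+n _) (≤double (≤-trans k<λ (m≤m+n _ (length nu)))) ,
       s≤s z≤n , ≤-trans (n≤1+n _) (≤double (≤-trans l<λ₁ (m≤m+n _ (part nu 1))))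
  square-bounds (νρ-square (suc k) (suc l) refl refl s) =
    let (k≤ν , _ , l≤ν₁) = inSkew-bounds nu rh (proj₁ skew-νρ) s
    in s≤s z≤n , ≤double (≤-trans k≤ν (m≤n+m _ (length la))) ,
       s≤s z≤n , ≤double (≤-trans l≤ν₁ (m≤n+m _ (part la 1)))
  square-bounds (νρ-square zero _ _ _ (() , _))
  square-bounds (νρ-square (suc k) zero _ _ (_ , () , _))

  width : ℕ → ℕ
  width r = countB (range 1 C) (inD la mu nu rh r)

  rowsAbove : ℕ → ℕ
  rowsAbove r = sum (map width (range 1 (r ∸ 1)))

  N : ℕ
  N = sizeD la mu nu rh

  ℓ : ℕ → ℕ → ℕ
  ℓ = label la mu nu rh

  private
    toTheRight : ℕ → ℕ → ℕ
    toTheRight r c = countB (range c C) (inD la mu nu rh r)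

    toTheRight-accept : ∀ {r c} → Square r c → toTheRight r c ≡ suc (toTheRight r (suc c))
    toTheRight-accept sq =
      let (_ , _ , 1≤c , c≤C) = square-bounds sq in countB-range-accept _ 1≤c c≤C (square⁻¹ sq)

    rowsAbove-suc : ∀ {r} → 1 ≤ r → rowsAbove (suc r) ≡ rowsAbove r + width r
    rowsAbove-suc {suc r} _ = sum-range-suc width r

  label-pos : ∀ {r c} → Square r c → 1 ≤ ℓ r c
  label-pos {r} sq = subst (λ n → 1 ≤ rowsAbove r + n) (sym (toTheRight-accept sq))
    (≤-trans (s≤s z≤n) (m≤n+m _ (rowsAbove r)))

  label-≤-rowsAbove-suc : ∀ {r c} → Square r c → ℓ r c ≤ rowsAbove (suc r)
  label-≤-rowsAbove-suc {r} {c} sq =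
    let (1≤r , _ , 1≤c , _) = square-bounds sq
    in subst (ℓ r c ≤_) (sym (rowsAbove-suc 1≤r))
         (+-monoʳ-≤ (rowsAbove r) (countB-range-antitone (inD la mu nu rh r) C 1≤c))

  label-≤-size : ∀ {r c} → Square r c → ℓ r c ≤ N
  label-≤-size sq = let (_ , r≤R , _ , _) = square-bounds sq in
    ≤-trans (label-≤-rowsAbove-suc sq) (sum-range-mono width r≤R)

  label-right-step : ∀ {r c} → Square r c → Square r (2 + c) → ℓ r c ≡ suc (ℓ r (2 + c))
  label-right-step {r} {c} sq sq₂ = let (_ , _ , _ , 2+c≤C) = square-bounds sq₂ in begin
    rowsAbove r + toTheRight r c                ≡⟨ cong (rowsAbove r +_) (toTheRight-accept sq) ⟩
    rowsAbove r + suc (toTheRight r (suc c))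
      ≡⟨ cong (λ n → rowsAbove r + suc n)
              (countB-range-reject _ (s≤s z≤n) (≤-trans (n≤1+n _) 2+c≤C) (no-square-right sq)) ⟩
    rowsAbove r + suc (toTheRight r (2 + c))    ≡⟨ +-suc (rowsAbove r) _ ⟩
    suc (rowsAbove r + toTheRight r (2 + c))    ∎
    where open ≡-Reasoning

  label-row-antitone : ∀ {r c c′} → Square r c → c < c′ → ℓ r c′ < ℓ r c
  label-row-antitone {r} sq c<c′ =
    +-monoʳ-< (rowsAbove r) (subst (_ <_) (sym (toTheRight-accept sq)) (s≤s (countB-range-antitone _ C c<c′)))

  label-column-mono : ∀ {r c r′ c′} → Square r c → Square r′ c′ → r < r′ → ℓ r c < ℓ r′ c′
  label-column-mono {r} {c} {suc r′} {c′} sq sq′ (s≤s r≤r′) = begin-strict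
    ℓ r c                 ≤⟨ label-≤-rowsAbove-suc sq ⟩
    rowsAbove (suc r)     ≤⟨ sum-range-mono width r≤r′ ⟩
    rowsAbove (suc r′)    <⟨ m<m+n _ (subst (0 <_) (sym (toTheRight-accept sq′)) (s≤s z≤n)) ⟩
    ℓ (suc r′) c′         ∎
    where open ≤-Reasoning

  IsSquare : Cell → Set
  IsSquare x = Square (proj₁ x) (proj₂ x)

  inDᶜ : Cell → Bool
  inDᶜ x = inD la mu nu rh (proj₁ x) (proj₂ x)

  labelᶜ : Cell → ℕ
  labelᶜ x = ℓ (proj₁ x) (proj₂ x)

  ReadBefore : Cell → Cell → Set
  ReadBefore = ×-Lex _≡_ _>_ _<_

  ReadBefore-irrefl : ∀ {x y} → ReadBefore x y → x ≢ y
  ReadBefore-irrefl (inj₁ r>r′)        refl = <-irrefl refl r>r′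
  ReadBefore-irrefl (inj₂ (_ , c<c′)) refl = <-irrefl refl c<c′

  label-decreasing : ∀ {x y} → ReadBefore x y → IsSquare x → IsSquare y → labelᶜ y < labelᶜ x
  label-decreasing (inj₁ r>r′)           sq sq′ = label-column-mono sq′ sq r>r′
  label-decreasing (inj₂ (refl , c<c′)) sq sq′ = label-row-antitone sq c<c′

  label-injective : ∀ {x y} → IsSquare x → IsSquare y → labelᶜ x ≡ labelᶜ y → x ≡ y
  label-injective {r , c} {r′ , c′} sq sq′ eq with <-cmp r r′ | <-cmp c c′
  ... | tri< r<r′ _ _ | _             = contradiction eq (<⇒≢ (label-column-mono sq sq′ r<r′))
  ... | tri> _ _ r>r′ | _             = contradiction (sym eq) (<⇒≢ (label-column-mono sq′ sq r>r′))
  ... | tri≈ _ refl _ | tri< c<c′ _ _ = contradiction (sym eq) (<⇒≢ (label-row-antitone sq c<c′))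
  ... | tri≈ _ refl _ | tri> _ _ c>c′ = contradiction eq (<⇒≢ (label-row-antitone sq′ c>c′))
  ... | tri≈ _ refl _ | tri≈ _ refl _ = refl

  readingOrder : List Cell
  readingOrder = cartesianProduct (reverse (range 1 R)) (range 1 C)

  readingOrder-sorted : AllPairs ReadBefore readingOrder
  readingOrder-sorted = cartesianProduct-lex rows-descending columns-ascending
    where
    rows-descending : AllPairs _>_ (reverse (range 1 R))
    rows-descending rewrite range-1 R | reverse-applyUpTo suc R =
      AllPairs.applyDownFrom⁺₁ suc R (λ j<i _ → s≤s j<i)
    columns-ascending : AllPairs _<_ (range 1 C)
    columns-ascending rewrite range-1 C = AllPairs.applyUpTo⁺₁ suc C (λ i<j _ → s≤s i<j)

  ∈-readingOrder : ∀ {x} → IsSquare x → x ∈ readingOrder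
  ∈-readingOrder sq = let (1≤r , r≤R , 1≤c , c≤C) = square-bounds sq in
    ∈-cartesianProduct⁺ (Any.reverse⁺ (∈-range-1 1≤r r≤R)) (∈-range-1 1≤c c≤C)

  squares : List Cell
  squares = filterᵇ inDᶜ readingOrder

  ∈-squares⁻ : ∀ {x} → x ∈ squares → IsSquare x
  ∈-squares⁻ x∈ = square (True⇒≡true (proj₂ (∈-filter⁻ (T? ∘ inDᶜ) {xs = readingOrder} x∈)))

  length-squares : length squares ≡ N
  length-squares = begin
    count inDᶜ readingOrder                ≡⟨ count-cartesianProduct inDᶜ (reverse (range 1 R)) (range 1 C) ⟩
    sum (map width (reverse (range 1 R)))  ≡⟨ cong sum (reverse-map width (range 1 R)) ⟩
    sum (reverse (map width (range 1 R)))  ≡⟨ sum-↭ (↭-reverse (map width (range 1 R))) ⟩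
    N                                      ∎
    where open ≡-Reasoning

  label-onto : ∀ {n} → 1 ≤ n → n ≤ N → ∃[ x ] IsSquare x × labelᶜ x ≡ n
  label-onto {n} 1≤n n≤N =
    let (x , x∈ , eq) = injective-into-interval⇒onto labelᶜ squares unique-squares
                          (λ x∈ y∈ → label-injective (∈-squares⁻ x∈) (∈-squares⁻ y∈)) bounds
                          1≤n (subst (n ≤_) (sym length-squares) n≤N)
    in x , ∈-squares⁻ x∈ , eq
    where
    unique-squares : Unique squares
    unique-squares = Unique.filter⁺ (T? ∘ inDᶜ) (AllPairs.map ReadBefore-irrefl readingOrder-sorted)
    bounds : ∀ {x} → x ∈ squares → 1 ≤ labelᶜ x × labelᶜ x ≤ length squares
    bounds {x} x∈ = let sq = ∈-squares⁻ x∈ in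
      label-pos sq , subst (labelᶜ x ≤_) (sym length-squares) (label-≤-size sq)

-- Standard Young tableaux

youngCells : List ℕ → List Cell
youngCells []      = []
youngCells (k ∷ κ) = map (1 ,_) (applyUpTo suc k) ++ map (map₁ suc) (youngCells κ)

∈-youngCells⁻ : ∀ κ {x} → x ∈ youngCells κ → InShape κ (proj₁ x) (proj₂ x)
∈-youngCells⁻ (k ∷ κ) x∈ with ∈-++⁻ (map (1 ,_) (applyUpTo suc k)) x∈
... | inj₁ x∈row with ∈-map⁻ (1 ,_) x∈row
...   | b , b∈ , refl with ∈-applyUpTo⁻ suc b∈
...     | j , j<k , refl = s≤s z≤n , s≤s z≤n , j<k
∈-youngCells⁻ (k ∷ κ) x∈ | inj₂ x∈rest with ∈-map⁻ (map₁ suc) x∈rest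
... | (suc a , b) , y∈ , refl = let (_ , 1≤b , b≤κₐ) = ∈-youngCells⁻ κ y∈ in s≤s z≤n , 1≤b , b≤κₐ
... | (zero , b) , y∈ , refl = contradiction (proj₁ (∈-youngCells⁻ κ y∈)) λ ()

length-youngCells : ∀ κ → length (youngCells κ) ≡ sum κ
length-youngCells []      = refl
length-youngCells (k ∷ κ) = begin
  length (map (1 ,_) (applyUpTo suc k) ++ map (map₁ suc) (youngCells κ))
    ≡⟨ length-++ (map (1 ,_) (applyUpTo suc k)) ⟩
  length (map (1 ,_) (applyUpTo suc k)) + length (map (map₁ suc) (youngCells κ))
    ≡⟨ cong₂ _+_ (trans (length-map (1 ,_) (applyUpTo suc k)) (length-applyUpTo suc k))
                 (trans (length-map (map₁ suc) (youngCells κ)) (length-youngCells κ)) ⟩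
  k + sum κ
    ∎
  where open ≡-Reasoning

unique-youngCells : ∀ κ → Unique (youngCells κ)
unique-youngCells []      = []
unique-youngCells (k ∷ κ) =
  Unique.++⁺ (Unique.map⁺ (cong proj₂) (Unique.applyUpTo⁺₁ suc k (λ i<j _ → <⇒≢ (s≤s i<j))))
             (Unique.map⁺ (λ eq → cong₂ _,_ (suc-injective (cong proj₁ eq)) (cong proj₂ eq)) (unique-youngCells κ))
             first-row-disjoint
  where
  first-row-disjoint : ∀ {x} → ¬ (x ∈ map (1 ,_) (applyUpTo suc k) × x ∈ map (map₁ suc) (youngCells κ))
  first-row-disjoint (x∈row , x∈rest) with ∈-map⁻ (1 ,_) x∈row | ∈-map⁻ (map₁ suc) x∈rest
  ... | _ , _ , refl | _ , y∈ , eq = <⇒≢ (proj₁ (∈-youngCells⁻ κ y∈)) (suc-injective (cong proj₁ eq))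

module Tableau (κ : List ℕ) (N : ℕ) (T : Filling) (syt : IsSYT κ N T) where

  Tᶜ : Cell → ℕ
  Tᶜ x = T (proj₁ x) (proj₂ x)

  T-bounds : ∀ a b → InShape κ a b → (1 ≤ T a b) × (T a b ≤ N)
  T-bounds = proj₁ (proj₂ (proj₂ syt))

  private
    κ-partition : IsPartition κ
    κ-partition = proj₁ syt

    T-injective : ∀ a b a′ b′ → InShape κ a b → InShape κ a′ b′ → T a b ≡ T a′ b′ → (a ≡ a′) × (b ≡ b′)
    T-injective = proj₁ (proj₂ (proj₂ (proj₂ syt)))

    T-increasing-right : ∀ a b → InShape κ a b → InShape κ a (suc b) → T a b < T a (suc b)
    T-increasing-right = proj₁ (proj₂ (proj₂ (proj₂ (proj₂ syt))))

  T-increasing-down : ∀ a b → InShape κ a b → InShape κ (suc a) b → T a b < T (suc a) b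
  T-increasing-down = proj₂ (proj₂ (proj₂ (proj₂ (proj₂ syt))))

  inShape-up : ∀ {a b} → 1 ≤ a → InShape κ (suc a) b → InShape κ a b
  inShape-up 1≤a (_ , 1≤b , b≤κ) = 1≤a , 1≤b , ≤-trans b≤κ (part-antitone κ κ-partition 1≤a (n≤1+n _))

  inShape-left : ∀ {a b b′} → 1 ≤ b → b ≤ b′ → InShape κ a b′ → InShape κ a b
  inShape-left 1≤b b≤b′ (1≤a , _ , b′≤κ) = 1≤a , 1≤b , ≤-trans b≤b′ b′≤κ

  T-row-mono : ∀ {a b b′} → InShape κ a b′ → 1 ≤ b → b ≤ b′ → T a b ≤ T a b′
  T-row-mono {a} {b} sh 1≤b b≤b′ = go (≤⇒≤′ b≤b′) sh
    where
    go : ∀ {b′} → b ≤′ b′ → InShape κ a b′ → T a b ≤ T a b′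
    go ≤′-refl _ = ≤-refl
    go (≤′-step {n = b″} b≤′b″) sh′ =
      let sh″ = inShape-left (≤-trans 1≤b (≤′⇒≤ b≤′b″)) (n≤1+n b″) sh′
      in ≤-trans (go b≤′b″ sh″) (<⇒≤ (T-increasing-right a b″ sh″ sh′))

  entry-unique : ∀ {n a b a′ b′} → EntryAt κ T n a b → EntryAt κ T n a′ b′ → (a ≡ a′) × (b ≡ b′)
  entry-unique (sh , eq) (sh′ , eq′) = T-injective _ _ _ _ sh sh′ (trans eq (sym eq′))

  T-onto : ∀ {n} → 1 ≤ n → n ≤ N → ∃[ x ] x ∈ youngCells κ × Tᶜ x ≡ n
  T-onto {n} 1≤n n≤N =
    injective-into-interval⇒onto Tᶜ (youngCells κ) (unique-youngCells κ) injective bounds 1≤n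
      (subst (n ≤_) (sym size) n≤N)
    where
    size : length (youngCells κ) ≡ N
    size = trans (length-youngCells κ) (proj₁ (proj₂ syt))
    injective : InjectiveOn Tᶜ (youngCells κ)
    injective x∈ y∈ eq =
      let (a≡ , b≡) = T-injective _ _ _ _ (∈-youngCells⁻ κ x∈) (∈-youngCells⁻ κ y∈) eq in cong₂ _,_ a≡ b≡
    bounds : ∀ {x} → x ∈ youngCells κ → 1 ≤ Tᶜ x × Tᶜ x ≤ length (youngCells κ)
    bounds {x} x∈ =
      let (1≤T , T≤N) = T-bounds _ _ (∈-youngCells⁻ κ x∈) in 1≤T , subst (Tᶜ x ≤_) (sym size) T≤N

  position : ℕ → Cell
  position n with any? (λ x → Tᶜ x ≟ n) (youngCells κ)
  ... | yes found = proj₁ (find found)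
  ... | no _      = 0 , 0

  position-correct : ∀ {n} → 1 ≤ n → n ≤ N → EntryAt κ T n (proj₁ (position n)) (proj₂ (position n))
  position-correct {n} 1≤n n≤N with any? (λ x → Tᶜ x ≟ n) (youngCells κ)
  ... | yes found = let (_ , x∈ , eq) = find found in ∈-youngCells⁻ κ x∈ , eq
  ... | no none   = let (x , x∈ , eq) = T-onto 1≤n n≤N in contradiction (lose x∈ eq) none

-- φ(T) for a D-compatible tableau T

module PhiOfCompatible (la mu nu rh : List ℕ) (skew-λμ : IsSkew la mu) (skew-νρ : IsSkew nu rh)
  (κ : List ℕ) (T : Filling) (syt : IsSYT κ (sizeD la mu nu rh) T)
  (compatible : IsCompatible la mu nu rh κ T) (S : Filling) (phi : IsPhi la mu nu rh κ T S) where

  open Diagram la mu nu rh skew-λμ skew-νρ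
  open Tableau κ N T syt

  Sᶜ : Cell → ℕ
  Sᶜ x = S (proj₁ x) (proj₂ x)

  entryRow entryCol : Cell → ℕ
  entryRow x = proj₁ (position (labelᶜ x))
  entryCol x = proj₂ (position (labelᶜ x))

  entry-of-square : ∀ {x} → IsSquare x → EntryAt κ T (labelᶜ x) (entryRow x) (entryCol x)
  entry-of-square sq = position-correct (label-pos sq) (label-≤-size sq)

  S≡row : ∀ {x} → IsSquare x → Sᶜ x ≡ entryRow x
  S≡row {x} sq = phi (proj₁ x) (proj₂ x) (square⁻¹ sq) _ _ (entry-of-square sq)

  label-in-row : ∀ {x v} → IsSquare x → Sᶜ x ≡ v → EntryAt κ T (labelᶜ x) v (entryCol x)
  label-in-row {x} sq refl =
    subst (λ a → EntryAt κ T (labelᶜ x) a (entryCol x)) (sym (S≡row sq)) (entry-of-square sq)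

  S-positive : ∀ {x} → IsSquare x → 1 ≤ Sᶜ x
  S-positive sq = subst (1 ≤_) (sym (S≡row sq)) (proj₁ (proj₁ (entry-of-square sq)))

  S-row-step : ∀ {r c} → Square r c → Square r (2 + c) → S r c ≤ S r (2 + c)
  S-row-step {r} {c} sq sq₂ = subst₂ _≤_ (sym (S≡row sq)) (sym (S≡row sq₂))
    (proj₁ (proj₁ compatible r (2 + c) c (square⁻¹ sq₂) (square⁻¹ sq) (label-right-step sq sq₂) _ _ _ _
      (entry-of-square sq) (entry-of-square sq₂)))

  column-compatible : ∀ {r c} → Square r c → Square (2 + r) c →
    (entryRow (r , c) < entryRow (2 + r , c)) × (entryCol (2 + r , c) ≤ entryCol (r , c))
  column-compatible {r} {c} sq sq₂ =
    proj₂ compatible r c (square⁻¹ sq) (square⁻¹ sq₂) _ _ _ _ (entry-of-square sq) (entry-of-square sq₂)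

  S-column-step : ∀ {r c} → Square r c → Square (2 + r) c → S r c < S (2 + r) c
  S-column-step sq sq₂ = subst₂ _<_ (sym (S≡row sq)) (sym (S≡row sq₂)) (proj₁ (column-compatible sq sq₂))

  S-row-weak : ∀ {r c c′} → Square r c → Square r c′ → c < c′ → S r c ≤ S r c′
  S-row-weak {r} = pairwise-from-adjacent (λ c c′ → S r c ≤ S r c′) ≤-trans square-row-step S-row-step

  S-column-strict : ∀ {r r′ c} → Square r c → Square r′ c → r < r′ → S r c < S r′ c
  S-column-strict {c = c} =
    pairwise-from-adjacent (λ r r′ → S r c < S r′ c) <-trans square-column-step S-column-step

  φ-shuffle : IsShuffleTableau la mu nu rh S
  φ-shuffle = (λ r c e → S-positive (square e))
            , (λ r c c′ e e′ → S-row-weak (square e) (square e′))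
            , (λ r r′ c e e′ → S-column-strict (square e) (square e′))

  module Yamanouchi (i : ℕ) (1≤i : 1 ≤ i) where

    below : Cell → Cell
    below x = 2 + proj₁ x , proj₂ x

    below-injective : ∀ {x y} → below x ≡ below y → x ≡ y
    below-injective eq = cong₂ _,_ (suc-injective (suc-injective (cong proj₁ eq))) (cong proj₂ eq)

    overlapped : Cell → Bool
    overlapped x = inOverlap la mu nu rh S i (proj₁ x) (proj₂ x)

    carries stacked free : ℕ → Cell → Bool
    carries v x = inDᶜ x ∧ (Sᶜ x ≡ᵇ v)
    stacked v x = carries v x ∧ overlapped x
    free    v x = carries v x ∧ not (overlapped x)

    carries⁻ : ∀ {v x} → True (carries v x) → IsSquare x × Sᶜ x ≡ v
    carries⁻ {v} {x} t = let (t₁ , t₂) = to T-∧ t in square (True⇒≡true t₁) , ≡ᵇ⇒≡ (Sᶜ x) v t₂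

    carries⁺ : ∀ {v x} → IsSquare x → Sᶜ x ≡ v → True (carries v x)
    carries⁺ {x = x} sq refl = from T-∧ (≡true⇒True (square⁻¹ sq) , ≡⇒≡ᵇ (Sᶜ x) (Sᶜ x) refl)

    private
      i≢1+i : i ≢ suc i
      i≢1+i = <⇒≢ (n<1+n i)

      nothing-between : ∀ {m} → i < m → m < suc i → ⊥
      nothing-between i<m m<1+i = <-irrefl refl (<-≤-trans i<m (≤-pred m<1+i))

    overlap-below : ∀ {x} → IsSquare x → Sᶜ x ≡ i → True (overlapped x) →
      IsSquare (below x) × Sᶜ (below x) ≡ suc i
    overlap-below {r , c} sq Sx≡i t with find (Any.any⁻ _ (range 1 R) t)
    ... | r′ , _ , t′ with to T-∧ t′
    ...   | t-sq′ , t-letters with to T-∨ t-letters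
    ...     | inj₂ t₂ = contradiction (trans (sym Sx≡i) (≡ᵇ⇒≡ _ _ (proj₁ (to T-∧ t₂)))) i≢1+i
    ...     | inj₁ t₁ with square {r′} {c} (True⇒≡true t-sq′) | ≡ᵇ⇒≡ _ _ (proj₂ (to T-∧ t₁))
    ...       | sq′ | S′≡1+i with <-cmp r r′
    ...         | tri≈ _ refl _ = contradiction (trans (sym Sx≡i) S′≡1+i) i≢1+i
    ...         | tri> _ _ r′<r =
                    contradiction (subst₂ _<_ S′≡1+i Sx≡i (S-column-strict sq′ sq r′<r)) (<⇒≯ (n<1+n i))
    ...         | tri< r<r′ _ _ with square-column-step sq sq′ r<r′
    ...           | sq₂ , 2+r≤r′ with m≤n⇒m<n∨m≡n 2+r≤r′
    ...             | inj₂ refl = sq₂ , S′≡1+i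
    ...             | inj₁ 2+r<r′ = ⊥-elim (nothing-between
                        (subst (_< S (2 + r) c) Sx≡i (S-column-step sq sq₂))
                        (subst (S (2 + r) c <_) S′≡1+i (S-column-strict sq₂ sq′ 2+r<r′)))

    overlap-above : ∀ {x} → IsSquare x → Sᶜ x ≡ i → IsSquare (below x) → Sᶜ (below x) ≡ suc i →
      True (overlapped (below x))
    overlap-above {r , c} sq Sx≡i sq₂ S₂≡1+i =
      let (1≤r , r≤R , _ , _) = square-bounds sq in
      Any.any⁺ _ (Any.map (λ { refl → witness }) (∈-range-1 1≤r r≤R))
      where
      witness : True (inD la mu nu rh r c ∧ (((S (2 + r) c ≡ᵇ i) ∧ (S r c ≡ᵇ suc i))
                                            ∨ ((S (2 + r) c ≡ᵇ suc i) ∧ (S r c ≡ᵇ i))))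
      witness = from T-∧ (≡true⇒True (square⁻¹ sq) ,
                          from T-∨ (inj₂ (from T-∧ (≡⇒≡ᵇ _ _ S₂≡1+i , ≡⇒≡ᵇ _ _ Sx≡i))))

    module DownClosed (zs : List Cell) (unique-zs : Unique zs)
      (closed : ∀ {x y} → x ∈ zs → IsSquare x → IsSquare y → labelᶜ y ≤ labelᶜ x → y ∈ zs) where

      belowIn : Cell → Bool
      belowIn x = does (below x ∈ᶜ? zs)

      belowIn⁻ : ∀ {x} → True (belowIn x) → below x ∈ zs
      belowIn⁻ {x} t with below x ∈ᶜ? zs
      ... | yes b∈ = b∈

      lonely paired source : Cell → Bool
      lonely x = stacked i x ∧ not (belowIn x)
      paired x = stacked i x ∧ belowIn x
      source x = carries (suc i) x ∨ lonely x

      data Source (x : Cell) : Set where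
        carrying-suc   : IsSquare x → Sᶜ x ≡ suc i → Source x
        lonely-overlap : IsSquare x → Sᶜ x ≡ i → True (overlapped x) → below x ∉ zs → Source x

      source⁻ : ∀ {x} → True (source x) → Source x
      source⁻ {x} t with to T-∨ t
      ... | inj₁ t₁ = let (sq , Sx≡) = carries⁻ t₁ in carrying-suc sq Sx≡
      ... | inj₂ t₂ =
        let (t-io , t-out) = to T-∧ t₂ ; (t-i , t-o) = to T-∧ t-io ; (sq , Sx≡) = carries⁻ t-i
        in lonely-overlap sq Sx≡ t-o (λ b∈ → outside t-out b∈)
        where
        outside : True (not (belowIn x)) → below x ∉ zs
        outside t-out b∈ with below x ∈ᶜ? zs
        ... | no b∉ = b∉ b∈

      source-square : ∀ {x} → Source x → IsSquare x
      source-square (carrying-suc sq _)       = sq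
      source-square (lonely-overlap sq _ _ _) = sq

      partner : Cell → Cell
      partner x = if Sᶜ x ≡ᵇ suc i then x else below x

      partner-carrying-suc : ∀ {x} → Sᶜ x ≡ suc i → partner x ≡ x
      partner-carrying-suc {x} Sx≡ = cong (λ b → if b then x else below x) (True⇒≡true (≡⇒≡ᵇ _ _ Sx≡))

      partner-lonely-overlap : ∀ {x} → Sᶜ x ≡ i → partner x ≡ below x
      partner-lonely-overlap {x} Sx≡ with Sᶜ x ≡ᵇ suc i in eq
      ... | true  = contradiction (trans (sym Sx≡) (≡ᵇ⇒≡ _ _ (≡true⇒True eq))) i≢1+i
      ... | false = refl

      partner-carries : ∀ {x} → Source x → IsSquare (partner x) × Sᶜ (partner x) ≡ suc i
      partner-carries (carrying-suc sq Sx≡) =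
        subst (λ y → IsSquare y × Sᶜ y ≡ suc i) (sym (partner-carrying-suc Sx≡)) (sq , Sx≡)
      partner-carries (lonely-overlap sq Sx≡ t-o _) =
        subst (λ y → IsSquare y × Sᶜ y ≡ suc i) (sym (partner-lonely-overlap Sx≡)) (overlap-below sq Sx≡ t-o)

      partner-injective : ∀ {x y} → x ∈ zs → y ∈ zs → Source x → Source y →
        partner x ≡ partner y → x ≡ y
      partner-injective _ _ (carrying-suc _ Sx≡) (carrying-suc _ Sy≡) eq =
        trans (sym (partner-carrying-suc Sx≡)) (trans eq (partner-carrying-suc Sy≡))
      partner-injective _ _ (lonely-overlap _ Sx≡ _ _) (lonely-overlap _ Sy≡ _ _) eq =
        below-injective (trans (sym (partner-lonely-overlap Sx≡)) (trans eq (partner-lonely-overlap Sy≡)))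
      partner-injective x∈ _ (carrying-suc _ Sx≡) (lonely-overlap _ Sy≡ _ below-y∉) eq =
        contradiction (subst (_∈ zs) (trans (sym (partner-carrying-suc Sx≡))
                                            (trans eq (partner-lonely-overlap Sy≡))) x∈) below-y∉
      partner-injective _ y∈ (lonely-overlap _ Sx≡ _ below-x∉) (carrying-suc _ Sy≡) eq =
        contradiction (subst (_∈ zs) (trans (sym (partner-carrying-suc Sy≡))
                                            (trans (sym eq) (partner-lonely-overlap Sx≡))) y∈) below-x∉

      entryAbovePartner : Cell → ℕ
      entryAbovePartner x = T i (entryCol (partner x))

      entryAbovePartner-≤-label : ∀ {x} → Source x →
        InShape κ i (entryCol (partner x)) × entryAbovePartner x ≤ labelᶜ x
      entryAbovePartner-≤-label {x} (carrying-suc sq Sx≡) rewrite partner-carrying-suc {x} Sx≡ =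
        let (sh , T≡ℓ) = label-in-row sq Sx≡ ; sh↑ = inShape-up 1≤i sh
        in sh↑ , <⇒≤ (subst (T i (entryCol x) <_) T≡ℓ (T-increasing-down i (entryCol x) sh↑ sh))
      entryAbovePartner-≤-label {x} (lonely-overlap sq Sx≡ t-o _) rewrite partner-lonely-overlap {x} Sx≡ =
        let (sq↓ , S↓≡) = overlap-below sq Sx≡ t-o
            (sh , T≡ℓ) = label-in-row sq Sx≡
            (sh↓ , _) = label-in-row sq↓ S↓≡
            β≤b = proj₂ (column-compatible sq sq↓)
            1≤β = proj₁ (proj₂ sh↓)
        in inShape-left 1≤β β≤b sh , subst (T i (entryCol (below x)) ≤_) T≡ℓ (T-row-mono sh 1≤β β≤b)

      entryAbovePartner-∈ : ∀ {x} → x ∈ zs → Source x →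
        entryAbovePartner x ∈ map labelᶜ (filterᵇ (carries i) zs)
      entryAbovePartner-∈ {x} x∈ src =
        let (sh , T≤ℓ) = entryAbovePartner-≤-label src
            (1≤T , T≤N) = T-bounds i (entryCol (partner x)) sh
            (y , sq-y , ℓy≡T) = label-onto 1≤T T≤N
            y∈ = closed x∈ (source-square src) sq-y (subst (_≤ labelᶜ x) (sym ℓy≡T) T≤ℓ)
            Sy≡i = trans (S≡row sq-y) (proj₁ (entry-unique (entry-of-square sq-y) (sh , sym ℓy≡T)))
        in subst (_∈ map labelᶜ (filterᵇ (carries i) zs)) ℓy≡T
             (∈-map⁺ labelᶜ (∈-filter⁺ (T? ∘ carries i) y∈ (carries⁺ sq-y Sy≡i)))

      entryAbovePartner-injective : InjectiveOn entryAbovePartner (filterᵇ source zs)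
      entryAbovePartner-injective {x} {y} x∈ y∈ eq =
        let (x∈zs , t-x) = ∈-filter⁻ (T? ∘ source) {xs = zs} x∈ ; src-x = source⁻ t-x
            (y∈zs , t-y) = ∈-filter⁻ (T? ∘ source) {xs = zs} y∈ ; src-y = source⁻ t-y
            (sq-x , Sx≡) = partner-carries src-x ; (sq-y , Sy≡) = partner-carries src-y
            (sh-x , _) = entryAbovePartner-≤-label src-x ; (sh-y , _) = entryAbovePartner-≤-label src-y
            βx≡βy = proj₂ (entry-unique {entryAbovePartner x} (sh-x , refl) (sh-y , sym eq))
            (_ , T≡ℓx) = label-in-row sq-x Sx≡ ; (_ , T≡ℓy) = label-in-row sq-y Sy≡
        in partner-injective x∈zs y∈zs src-x src-y
             (label-injective sq-x sq-y (trans (sym T≡ℓx) (trans (cong (T (suc i)) βx≡βy) T≡ℓy)))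

      count-source-≤ : count source zs ≤ count (carries i) zs
      count-source-≤ = subst (count source zs ≤_) (length-map labelᶜ (filterᵇ (carries i) zs))
        (length-≤-of-injection _≟_ entryAbovePartner (Unique.filter⁺ (T? ∘ source) unique-zs)
          entryAbovePartner-injective
          (λ x∈ → let (x∈zs , t) = ∈-filter⁻ (T? ∘ source) {xs = zs} x∈ in
                  entryAbovePartner-∈ x∈zs (source⁻ t)))

      count-paired-≤ : count paired zs ≤ count (stacked (suc i)) zs
      count-paired-≤ =
        length-≤-of-injection (≡-dec _≟_ _≟_) below (Unique.filter⁺ (T? ∘ paired) unique-zs)
          (λ _ _ → below-injective) lands
        where
        lands : ∀ {x} → x ∈ filterᵇ paired zs → below x ∈ filterᵇ (stacked (suc i)) zs
        lands {x} x∈ =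
          let (t-io , t-in) = to T-∧ (proj₂ (∈-filter⁻ (T? ∘ paired) {xs = zs} x∈))
              (t-i , t-o) = to T-∧ t-io
              (sq , Sx≡) = carries⁻ t-i ; (sq↓ , S↓≡) = overlap-below sq Sx≡ t-o
          in ∈-filter⁺ (T? ∘ stacked (suc i)) (belowIn⁻ t-in)
               (from T-∧ (carries⁺ sq↓ S↓≡ , overlap-above sq Sx≡ sq↓ S↓≡))

      balanced : count (free (suc i)) zs ≤ count (free i) zs
      balanced = exchange-cancel (subst₂ _≤_ count-source count-carries-i count-source-≤) count-paired-≤
        where
        disjoint : ∀ x → True (carries (suc i) x) → True (lonely x) → ⊥
        disjoint x t₁ t₂ =
          let (_ , S≡i) = carries⁻ (proj₁ (to T-∧ (proj₁ (to T-∧ t₂)))) ; (_ , S≡1+i) = carries⁻ t₁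
          in i≢1+i (trans (sym S≡i) S≡1+i)
        count-source : count source zs ≡ (count (stacked (suc i)) zs + count (free (suc i)) zs) + count lonely zs
        count-source = trans (count-∨ (carries (suc i)) lonely zs disjoint)
                             (cong (_+ count lonely zs) (count-split (carries (suc i)) overlapped zs))
        count-carries-i : count (carries i) zs ≡ (count paired zs + count lonely zs) + count (free i) zs
        count-carries-i = trans (count-split (carries i) overlapped zs)
                                (cong (_+ count (free i) zs) (count-split (stacked i) belowIn zs))

    inReadingWord : Cell → Bool
    inReadingWord x = inDᶜ x ∧ ((Sᶜ x ≡ᵇ i) ∨ (Sᶜ x ≡ᵇ suc i)) ∧ not (overlapped x)

    word : List Cell → List ℕ
    word = concatMap (select inReadingWord Sᶜ)

    readingWord≡ : readingWord la mu nu rh S i ≡ word readingOrder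
    readingWord≡ =
      concatMap-cartesianProduct (λ r c → select inReadingWord Sᶜ (r , c)) (reverse (range 1 R)) (range 1 C)

    opens-word : ∀ zs → opens i (word zs) ≡ count (free (suc i)) zs
    opens-word zs = trans (count-concatMap-select inReadingWord Sᶜ (_≡ᵇ suc i) zs)
      (count-cong _ _ zs (λ x → ∧-∨-restrictʳ (inDᶜ x) (Sᶜ x ≡ᵇ i) (Sᶜ x ≡ᵇ suc i) (overlapped x)))

    closes-word : ∀ zs → closes i (word zs) ≡ count (free i) zs
    closes-word zs = trans (count-concatMap-select inReadingWord Sᶜ (λ a → not (a ≡ᵇ suc i)) zs)
      (count-cong _ _ zs (λ x → ∧-∨-restrictˡ (inDᶜ x) (Sᶜ x ≡ᵇ i) (Sᶜ x ≡ᵇ suc i) (overlapped x)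
        (λ t t′ → i≢1+i (trans (sym (≡ᵇ⇒≡ (Sᶜ x) i t)) (≡ᵇ⇒≡ (Sᶜ x) (suc i) t′)))))

    suffixes-balanced : EverySuffix (Balanced i) (readingWord la mu nu rh S i)
    suffixes-balanced us v eq
      with suffix-concatMap-select inReadingWord Sᶜ readingOrder {us} {v} (trans eq readingWord≡)
    ... | ys , zs , ys++zs≡ , refl =
      subst₂ _≤_ (sym (opens-word zs)) (sym (closes-word zs))
        (DownClosed.balanced zs (AllPairs.map ReadBefore-irrefl sorted-zs) closed)
      where
      sorted = allPairs-++⁻ ys (subst (AllPairs ReadBefore) (sym ys++zs≡) readingOrder-sorted)
      sorted-zs = proj₁ sorted
      closed : ∀ {x y} → x ∈ zs → IsSquare x → IsSquare y → labelᶜ y ≤ labelᶜ x → y ∈ zs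
      closed x∈ sq-x sq-y ℓy≤ℓx with ∈-++⁻ ys (subst (_ ∈_) (sym ys++zs≡) (∈-readingOrder sq-y))
      ... | inj₂ y∈ = y∈
      ... | inj₁ y∈ = contradiction ℓy≤ℓx (<⇒≱ (label-decreasing (proj₂ sorted y∈ x∈) sq-y sq-x))

    not-applicable : ¬ EApplicable la mu nu rh S i
    not-applicable applicable = contradiction (subst (1 ≤_) no-unmatched applicable) λ ()
      where
      no-unmatched : unmatchedOpen i 0 (readingWord la mu nu rh S i) ≡ 0
      no-unmatched = unmatchedOpen-≡0 i 0 _ suffixes-balanced (suffixes-balanced [] _ refl)

lemma2p15 : (la mu nu rh : List ℕ) → IsSkew la mu → IsSkew nu rh →
            (κ : List ℕ) (T : Filling) → IsSYT κ (sizeD la mu nu rh) T →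
            IsCompatible la mu nu rh κ T →
            (S : Filling) → IsPhi la mu nu rh κ T S →
            IsShuffleTableau la mu nu rh S × IsYamanouchi la mu nu rh S
lemma2p15 la mu nu rh skew-λμ skew-νρ κ T syt compatible S phi =
  φ-shuffle , λ i 1≤i → Yamanouchi.not-applicable i 1≤i
  where open PhiOfCompatible la mu nu rh skew-λμ skew-νρ κ T syt compatible S phi
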